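{- For every integer $k\geq 2$, if a graph $G$ has minimum degree $\delta\geq \frac{7}{4}k^2+\frac{1}{2}k$, then $G$ has a $\frac{1}{k}$-majority $(k+1)$-edge-colouring.
   Context: Graphs are finite and simple. For an integer $k\geq 2$, a $\frac{1}{k}$-majority $l$-edge-colouring of a graph $G$ is an assignment to each edge of $G$ of one of $l$ colours such that for every colour $i$ and every vertex $v$ of $G$, at most $\frac{d_G(v)}{k}$ of the edges incident with $v$ have colour $i$ (where $d_G(v)$ is the degree of $v$). -}

module Defs where

open import Data.Nat using (ℕ; suc; _+_; _*_; _≤_)
open import Data.Bool using (Bool; true; false; _∧_)
open import Data.Fin using (Fin)
open import Data.Fin.Properties using (_≟_)
open import Data.List using (List; filter; length)
open import Data.List using (allFin) public
open import Relation.Binary.PropositionalEquality using (_≡_)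
open import Relation.Nullary.Decidable using (⌊_⌋)

record Graph (n : ℕ) : Set where
  field
    adj   : Fin n → Fin n → Bool
    sym   : ∀ u v → adj u v ≡ adj v u
    irrefl : ∀ v → adj v v ≡ false

open Graph public

count : {n : ℕ} → (Fin n → Bool) → ℕ
count {n} p = length (filter (λ u → p u Data.Bool.≟ true) (allFin n))

degree : {n : ℕ} → Graph n → Fin n → ℕ
degree G v = count (adj G v)

-- An l-edge-colouring: a colour for each edge {u,v}. Represented by a
-- function on ordered pairs that is symmetric on edges (values on
-- non-edges are irrelevant).
record EdgeColouring {n : ℕ} (G : Graph n) (l : ℕ) : Set where
  field
    colour : Fin n → Fin n → Fin l
    colour-sym : ∀ u v → adj G u v ≡ true → colour u v ≡ colour v u

open EdgeColouring public

colourDegree : {n l : ℕ} {G : Graph n} → EdgeColouring G l → Fin l → Fin n → ℕ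
colourDegree {G = G} c i v =
  count (λ u → adj G v u ∧ ⌊ colour c v u ≟ i ⌋)

-- 1/k-majority: for every colour i and vertex v,
-- (#edges at v of colour i) ≤ d(v)/k, i.e. k * #… ≤ d(v).
IsMajority : {n l : ℕ} {G : Graph n} → ℕ → EdgeColouring G l → Set
IsMajority {G = G} k c = ∀ i v → k * colourDegree c i v ≤ degree G v

module Submission where

-- With t(v) = ⌊d(v)/k⌋, a colouring whose colour degrees at every v are at most t(v) is
-- 1/k-majority. Starting from any (k+1)-edge-colouring, lower lexicographically the pair
-- (Σ_v Σ_b max(0, d_b(v) − t(v)), Σ_v Σ_b d_b(v)²) of an excess and a square potential.
-- If two colour degrees at a vertex differ by at least 3, exchange these two colours along a
-- maximal trail from there alternating between them: only the ends of the trail change their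
-- colour degrees, each by moving one or two units towards balance, so no convex potential
-- increases and the square potential drops. Otherwise colour degrees at a vertex differ by at
-- most 2. If colour i exceeds t(v) at v, recolouring with j an i-edge vu such that j is below
-- target at both v and u lowers the excess. If no such edge exists, counting colours below
-- target at v gives t(v) + 2 ≤ k + #below at v and t(u) + 1 ≤ k + 2·#other at u, whereas
-- δ ≥ 7k²/4 + k/2 forces 4t ≥ 7k − 1 at both vertices; these are incompatible.

module FinEquality where

  open import Data.Bool using (Bool; true; false)
  open import Data.Fin using (Fin)
  open import Data.Fin.Properties using (_≟_)
  open import Data.Fin.Permutation.Components using (transpose; transpose-inverse)
  open import Relation.Binary.PropositionalEquality
  open import Relation.Nullary using (yes; no; contradiction)
  open import Relation.Nullary.Decidable using (⌊_⌋; dec-true; dec-false; isYes≗does)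

  _==_ : ∀ {n} → Fin n → Fin n → Bool
  a == b = ⌊ a ≟ b ⌋

  ==-refl : ∀ {n} (a : Fin n) → (a == a) ≡ true
  ==-refl a = trans (isYes≗does (a ≟ a)) (dec-true (a ≟ a) refl)

  ==-≢ : ∀ {n} {a b : Fin n} → a ≢ b → (a == b) ≡ false
  ==-≢ {a = a} {b} a≢b = trans (isYes≗does (a ≟ b)) (dec-false (a ≟ b) a≢b)

  ==⇒≡ : ∀ {n} {a b : Fin n} → (a == b) ≡ true → a ≡ b
  ==⇒≡ {a = a} {b} eq with a ≟ b
  ... | yes a≡b = a≡b

  ==-cong-⇔ : ∀ {m} {a b c d : Fin m} → (a ≡ b → c ≡ d) → (c ≡ d → a ≡ b) → (a == b) ≡ (c == d)
  ==-cong-⇔ {a = a} {b} {c} {d} to from with a ≟ b | c ≟ d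
  ... | yes _   | yes _   = refl
  ... | no _    | no _    = refl
  ... | yes a≡b | no c≢d  = contradiction (to a≡b) c≢d
  ... | no a≢b  | yes c≡d = contradiction (from c≡d) a≢b

  transpose-== : ∀ {m} (i j a b : Fin m) → (transpose i j a == b) ≡ (a == transpose j i b)
  transpose-== i j a b = ==-cong-⇔
    (λ { refl → sym (transpose-inverse j i) })
    (λ { refl → transpose-inverse i j })

  transpose-left : ∀ {m} (i j : Fin m) → transpose i j i ≡ j
  transpose-left i j rewrite dec-true (i ≟ i) refl = refl

  transpose-right : ∀ {m} (i j : Fin m) → transpose i j j ≡ i
  transpose-right i j with j ≟ i
  ... | yes j≡i = j≡i
  ... | no _ rewrite dec-true (j ≟ j) refl = refl

  transpose-other : ∀ {m} {i j b : Fin m} → b ≢ i → b ≢ j → transpose i j b ≡ b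
  transpose-other {i = i} {j} {b} b≢i b≢j rewrite dec-false (b ≟ i) b≢i | dec-false (b ≟ j) b≢j = refl

module FiniteSums where

  open import Data.Nat hiding (_≟_)
  open import Data.Nat.Properties hiding (_≟_)
  open import Data.Bool using (Bool; true; false)
  import Data.Bool as Bool
  open import Data.Fin using (Fin; zero; suc)
  open import Data.Fin.Properties using (_≟_)
  import Data.Fin.Properties as Fin
  open import Data.List using (filter; length; tabulate; allFin)
  open import Data.Product using (∃; _,_)
  open import Function using (_∘_; id)
  open import Relation.Binary.PropositionalEquality
  open import Relation.Nullary using (yes; no; contradiction)
  open import Data.Nat.Tactic.RingSolver using (solve-∀)
  open import Algebra.Properties.CommutativeMonoid.Sum +-0-commutativeMonoid
    public using (sum; sum-syntax; ∑-comm; ∑-distrib-+; sum-cong-≗)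
  open FinEquality

  𝟙 : Bool → ℕ
  𝟙 true = 1
  𝟙 false = 0

  𝟙-positive : ∀ {β} → 0 < 𝟙 β → Bool.T β
  𝟙-positive {true} _ = _

  length-filter-tabulate : ∀ {m n} (p : Fin m → Bool) (g : Fin n → Fin m) →
    length (filter (λ u → p u Bool.≟ true) (tabulate g)) ≡ ∑[ x < n ] 𝟙 (p (g x))
  length-filter-tabulate {n = zero} p g = refl
  length-filter-tabulate {n = suc n} p g with p (g zero)
  ... | true = cong suc (length-filter-tabulate p (g ∘ suc))
  ... | false = length-filter-tabulate p (g ∘ suc)

  length-filter-allFin : ∀ {n} (p : Fin n → Bool) →
    length (filter (λ u → p u Bool.≟ true) (allFin n)) ≡ ∑[ x < n ] 𝟙 (p x)
  length-filter-allFin p = length-filter-tabulate p id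

  sum-const : ∀ n a → ∑[ x < n ] a ≡ n * a
  sum-const zero a = refl
  sum-const (suc n) a = cong (a +_) (sum-const n a)

  sum-zero : ∀ n → ∑[ x < n ] 0 ≡ 0
  sum-zero n = trans (sum-const n 0) (*-zeroʳ n)

  sum-mono-≤ : ∀ {n} {f g : Fin n → ℕ} → (∀ x → f x ≤ g x) → sum f ≤ sum g
  sum-mono-≤ {zero} f≤g = z≤n
  sum-mono-≤ {suc n} f≤g = +-mono-≤ (f≤g zero) (sum-mono-≤ (f≤g ∘ suc))

  sum-mono-< : ∀ {n} {f g : Fin n → ℕ} → (∀ x → f x ≤ g x) → ∀ a → f a < g a → sum f < sum g
  sum-mono-< {suc n} f≤g zero fa<ga = +-mono-<-≤ fa<ga (sum-mono-≤ (f≤g ∘ suc))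
  sum-mono-< {suc n} f≤g (suc a) fa<ga = +-mono-≤-< (f≤g zero) (sum-mono-< (f≤g ∘ suc) a fa<ga)

  sum-positive : ∀ {n} (f : Fin n → ℕ) → 0 < sum f → ∃ λ a → 0 < f a
  sum-positive {suc n} f 0<Σ with f zero in eq
  ... | suc _ = zero , subst (0 <_) (sym eq) z<s
  ... | zero  = let a , 0<fa = sum-positive (f ∘ suc) 0<Σ in suc a , 0<fa

  sum-update : ∀ {n} (f f' : Fin n → ℕ) a → (∀ x → x ≢ a → f' x ≡ f x) →
    sum f' + f a ≡ sum f + f' a
  sum-update {suc n} f f' zero agree =
    begin
      f' zero + sum (f' ∘ suc) + f zero ≡⟨ cong (λ s → f' zero + s + f zero) (sum-cong-≗ (λ x → agree (suc x) λ ())) ⟩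
      f' zero + sum (f ∘ suc) + f zero  ≡⟨ shuffle (f' zero) (sum (f ∘ suc)) (f zero) ⟩
      f zero + sum (f ∘ suc) + f' zero  ∎
    where
    open ≡-Reasoning
    shuffle : ∀ a s b → a + s + b ≡ b + s + a
    shuffle = solve-∀
  sum-update {suc n} f f' (suc a) agree =
    begin
      f' zero + sum (f' ∘ suc) + f (suc a) ≡⟨ cong (λ z → z + sum (f' ∘ suc) + f (suc a)) (agree zero λ ()) ⟩
      f zero + sum (f' ∘ suc) + f (suc a)  ≡⟨ +-assoc (f zero) _ _ ⟩
      f zero + (sum (f' ∘ suc) + f (suc a)) ≡⟨ cong (f zero +_) (sum-update (f ∘ suc) (f' ∘ suc) a agree-suc) ⟩
      f zero + (sum (f ∘ suc) + f' (suc a)) ≡⟨ +-assoc (f zero) _ _ ⟨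
      f zero + sum (f ∘ suc) + f' (suc a)  ∎
    where
    open ≡-Reasoning
    agree-suc : ∀ x → x ≢ a → f' (suc x) ≡ f (suc x)
    agree-suc x x≢a = agree (suc x) (x≢a ∘ Fin.suc-injective)

  sum-update₂ : ∀ {n} (f f' : Fin n → ℕ) a b → a ≢ b → (∀ x → x ≢ a → x ≢ b → f' x ≡ f x) →
    sum f' + (f a + f b) ≡ sum f + (f' a + f' b)
  sum-update₂ f f' a b a≢b agree = +-cancelʳ-≡ (sum h) _ _ (begin
      sum f' + (f a + f b) + sum h ≡⟨ regroup (sum f') (f a) (f b) (sum h) ⟩
      (sum f' + f b) + (sum h + f a) ≡⟨ cong₂ _+_ (sym (trans (sum-update f' h b h≗f'-off-b) (cong (sum f' +_) h-at-b)))
                                                   (trans (sum-update f h a h≗f-off-a) (cong (sum f +_) h-at-a)) ⟩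
      (sum h + f' b) + (sum f + f' a) ≡⟨ regroup′ (sum h) (f' b) (sum f) (f' a) ⟩
      sum f + (f' a + f' b) + sum h ∎)
    where
    open ≡-Reasoning
    h : _ → ℕ
    h x with x ≟ b
    ... | yes _ = f x
    ... | no _  = f' x
    h-at-b : h b ≡ f b
    h-at-b with b ≟ b
    ... | yes _ = refl
    ... | no b≢b = contradiction refl b≢b
    h-at-a : h a ≡ f' a
    h-at-a with a ≟ b
    ... | yes a≡b = contradiction a≡b a≢b
    ... | no _ = refl
    h≗f'-off-b : ∀ x → x ≢ b → h x ≡ f' x
    h≗f'-off-b x x≢b with x ≟ b
    ... | yes x≡b = contradiction x≡b x≢b
    ... | no _ = refl
    h≗f-off-a : ∀ x → x ≢ a → h x ≡ f x
    h≗f-off-a x x≢a with x ≟ b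
    ... | yes _ = refl
    ... | no x≢b = agree x x≢a x≢b
    regroup : ∀ s p q t → s + (p + q) + t ≡ (s + q) + (t + p)
    regroup = solve-∀
    regroup′ : ∀ t p s q → (t + p) + (s + q) ≡ s + (q + p) + t
    regroup′ = solve-∀

  sum-𝟙-== : ∀ {n} (a : Fin n) → ∑[ b < n ] 𝟙 (a == b) ≡ 1
  sum-𝟙-== {n} a = begin
    ∑[ b < n ] 𝟙 (a == b) ≡⟨ +-identityʳ _ ⟨
    ∑[ b < n ] 𝟙 (a == b) + 0 ≡⟨ sum-update (λ _ → 0) (λ b → 𝟙 (a == b)) a (λ b b≢a → cong 𝟙 (==-≢ (b≢a ∘ sym))) ⟩
    ∑[ b < n ] 0 + 𝟙 (a == a) ≡⟨ cong₂ _+_ (sum-zero n) (cong 𝟙 (==-refl a)) ⟩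
    1 ∎
    where open ≡-Reasoning

module Convexity where

  open import Data.Nat
  open import Data.Nat.Properties
  open import Relation.Binary.PropositionalEquality
  open import Relation.Nullary using (yes; no)
  open import Data.Nat.Tactic.RingSolver using (solve-∀)

  Convex : (ℕ → ℕ) → Set
  Convex g = ∀ {a b} → b ≤ a → g a + g (suc b) ≤ g (suc a) + g b

  square : ℕ → ℕ
  square a = a * a

  private
    square-expandʳ : ∀ a b → a * a + suc b * suc b ≡ a * a + b * b + (b + b) + 1
    square-expandʳ = solve-∀

    square-expandˡ : ∀ a b → suc a * suc a + b * b ≡ a * a + b * b + (a + a) + 1
    square-expandˡ = solve-∀

  square-convex : Convex square
  square-convex {a} {b} b≤a = begin
    square a + square (suc b)         ≡⟨ square-expandʳ a b ⟩
    square a + square b + (b + b) + 1 ≤⟨ +-monoˡ-≤ 1 (+-monoʳ-≤ (square a + square b) (+-mono-≤ b≤a b≤a)) ⟩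
    square a + square b + (a + a) + 1 ≡⟨ square-expandˡ a b ⟨
    square (suc a) + square b         ∎
    where open ≤-Reasoning

  square-strictlyConvex : ∀ {a b} → b < a → square a + square (suc b) < square (suc a) + square b
  square-strictlyConvex {a} {b} b<a = begin-strict
    square a + square (suc b)         ≡⟨ square-expandʳ a b ⟩
    square a + square b + (b + b) + 1 <⟨ +-monoˡ-< 1 (+-monoʳ-< (square a + square b) (+-mono-< b<a b<a)) ⟩
    square a + square b + (a + a) + 1 ≡⟨ square-expandˡ a b ⟨
    square (suc a) + square b         ∎
    where open ≤-Reasoning

  module _ (t : ℕ) where

    ∸-shift-below : ∀ {a b} → b < t → (a ∸ t) + (suc b ∸ t) ≤ (suc a ∸ t) + (b ∸ t)
    ∸-shift-below {a} {b} b<t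
      rewrite m≤n⇒m∸n≡0 b<t | m≤n⇒m∸n≡0 (<⇒≤ b<t) = +-monoˡ-≤ 0 (∸-monoˡ-≤ t (n≤1+n a))

    ∸-shift-across : ∀ {a b} → b < t → t ≤ a → (a ∸ t) + (suc b ∸ t) < (suc a ∸ t) + (b ∸ t)
    ∸-shift-across {a} {b} b<t t≤a
      rewrite m≤n⇒m∸n≡0 b<t | m≤n⇒m∸n≡0 (<⇒≤ b<t) | +-∸-assoc 1 t≤a = n<1+n _

    ∸-convex : Convex (_∸ t)
    ∸-convex {a} {b} b≤a with suc b ≤? t
    ... | yes b<t = ∸-shift-below b<t
    ... | no b≮t = ≤-reflexive (begin
      (a ∸ t) + (suc b ∸ t)   ≡⟨ cong ((a ∸ t) +_) (+-∸-assoc 1 t≤b) ⟩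
      (a ∸ t) + suc (b ∸ t)   ≡⟨ +-suc (a ∸ t) (b ∸ t) ⟩
      suc (a ∸ t) + (b ∸ t)   ≡⟨ cong (_+ (b ∸ t)) (+-∸-assoc 1 (≤-trans t≤b b≤a)) ⟨
      (suc a ∸ t) + (b ∸ t)   ∎)
      where
      open ≡-Reasoning
      t≤b : t ≤ b
      t≤b = ≮⇒≥ b≮t

  module _ {a b a' b' : ℕ} where

    convex-transferʳ : ∀ {g} → Convex g → a ≡ suc a' → b' ≡ suc b → b < a → g a' + g b' ≤ g a + g b
    convex-transferʳ convex refl refl b<a = convex (≤-pred b<a)

    convex-transferˡ : ∀ {g} → Convex g → b ≡ suc b' → a' ≡ suc a → a < b → g a' + g b' ≤ g a + g b
    convex-transferˡ {g} convex refl refl a<b =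
      subst₂ _≤_ (+-comm (g b') (g (suc a))) (+-comm (g (suc b')) (g a)) (convex (≤-pred a<b))

    convex-transferʳ₂ : ∀ {g} → Convex g → a ≡ 2 + a' → b' ≡ 2 + b → 2 + b < a → g a' + g b' ≤ g a + g b
    convex-transferʳ₂ convex refl refl b+2<a =
      ≤-trans (convex (≤-pred (≤-pred b+2<a))) (convex (m≤n⇒m≤1+n (<⇒≤ (≤-pred (≤-pred b+2<a)))))

    square-transfer-< : a ≡ suc a' → b' ≡ suc b → suc b < a → square a' + square b' < square a + square b
    square-transfer-< refl refl b+1<a = square-strictlyConvex (≤-pred b+1<a)

    square-transfer₂-< : a ≡ 2 + a' → b' ≡ 2 + b → 2 + b < a → square a' + square b' < square a + square b
    square-transfer₂-< refl refl b+2<a =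
      ≤-<-trans (square-convex (≤-pred (≤-pred b+2<a))) (square-strictlyConvex (m≤n⇒m≤1+n (≤-pred (≤-pred b+2<a))))

    ∸-transfer-below : ∀ t → a ≡ suc a' → b' ≡ suc b → b < t → (a' ∸ t) + (b' ∸ t) ≤ (a ∸ t) + (b ∸ t)
    ∸-transfer-below t refl refl = ∸-shift-below t

    ∸-transfer-across : ∀ t → a ≡ suc a' → b' ≡ suc b → b < t → t < a → (a' ∸ t) + (b' ∸ t) < (a ∸ t) + (b ∸ t)
    ∸-transfer-across t refl refl b<t t<a = ∸-shift-across t b<t (≤-pred t<a)

module SlackArithmetic where

  open import Data.Nat
  open import Data.Nat.Properties
  open import Data.Nat.DivMod using (_/_; _%_; m/n*n≤m; m≡m%n+[m/n]*n; m%n<n)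
  open import Data.Empty using (⊥)
  open import Relation.Nullary using (contradiction)
  open import Relation.Binary.PropositionalEquality
  open import Data.Nat.Tactic.RingSolver using (solve-∀)

  module _ (K : ℕ) .{{_ : NonZero K}} where

    K*[d/K]≤d : ∀ d → K * (d / K) ≤ d
    K*[d/K]≤d d = subst (_≤ d) (*-comm (d / K) K) (m/n*n≤m d K)

    d<K*[d/K]+K : ∀ d → d < K * (d / K) + K
    d<K*[d/K]+K d = begin-strict
      d                         ≡⟨ m≡m%n+[m/n]*n d K ⟩
      d % K + d / K * K         <⟨ +-monoˡ-< (d / K * K) (m%n<n d K) ⟩
      K + d / K * K             ≡⟨ +-comm K _ ⟩
      d / K * K + K             ≡⟨ cong (_+ K) (*-comm (d / K) K) ⟩
      K * (d / K) + K           ∎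
      where open ≤-Reasoning

  module _ (K t : ℕ) where

    slack : ∀ {s d m} → (K + 1) * t + s ≤ d + m → d < K * t + K → t + suc s ≤ K + m
    slack {s} {d} {m} lower upper = +-cancelˡ-≤ (K * t) _ _ (begin
      K * t + (t + suc s)  ≡⟨ regroup K t s ⟩
      (K + 1) * t + s + 1  ≤⟨ +-monoˡ-≤ 1 lower ⟩
      d + m + 1            ≡⟨ +-comm (d + m) 1 ⟩
      suc d + m            ≤⟨ +-monoˡ-≤ m upper ⟩
      K * t + K + m        ≡⟨ +-assoc (K * t) K m ⟩
      K * t + (K + m)      ∎)
      where
      open ≤-Reasoning
      regroup : ∀ K t s → K * t + (t + suc s) ≡ (K + 1) * t + s + 1
      regroup = solve-∀

    quotient-large : ∀ {d} → 7 * (K * K) + 2 * K ≤ 4 * d → d < K * t + K → 7 * K ≤ 4 * t + 1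
    quotient-large {d} δ upper = ≤-pred (≤-pred (≤-pred (subst₂ _≤_ (lhs K) (rhs t) (*-cancelˡ-< K _ _ (begin-strict
      K * (7 * K + 2)     ≡⟨ factorˡ K ⟨
      7 * (K * K) + 2 * K ≤⟨ δ ⟩
      4 * d               <⟨ *-monoʳ-< 4 upper ⟩
      4 * (K * t + K)     ≡⟨ factorʳ K t ⟩
      K * (4 * t + 4)     ∎)))))
      where
      open ≤-Reasoning
      factorˡ : ∀ K → 7 * (K * K) + 2 * K ≡ K * (7 * K + 2)
      factorˡ = solve-∀
      factorʳ : ∀ K t → 4 * (K * t + K) ≡ K * (4 * t + 4)
      factorʳ = solve-∀
      lhs : ∀ K → suc (7 * K + 2) ≡ 3 + 7 * K
      lhs = solve-∀
      rhs : ∀ t → 4 * t + 4 ≡ 3 + (4 * t + 1)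
      rhs = solve-∀

  quotient-large⇒slack-positive : ∀ {K t m} → 7 * K ≤ 4 * t + 1 → t + 2 ≤ K + m → 0 < m
  quotient-large⇒slack-positive {m = suc m} _ _ = z<s
  quotient-large⇒slack-positive {K} {t} {zero} large small = contradiction (≤-trans (m≤n+m 7 (3 * K)) (+-cancelˡ-≤ (4 * K) _ _ (begin
    4 * K + (3 * K + 7) ≡⟨ regroup K ⟩
    7 * K + 7           ≤⟨ +-monoˡ-≤ 7 large ⟩
    4 * t + 1 + 7       ≡⟨ regroup′ t ⟩
    4 * (t + 2)         ≤⟨ *-monoʳ-≤ 4 small ⟩
    4 * (K + 0)         ≡⟨ *-distribˡ-+ 4 K 0 ⟩
    4 * K + 4 * 0       ∎))) λ ()
    where
    open ≤-Reasoning
    regroup : ∀ K → 4 * K + (3 * K + 7) ≡ 7 * K + 7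
    regroup = solve-∀
    regroup′ : ∀ t → 4 * t + 1 + 7 ≡ 4 * (t + 2)
    regroup′ = solve-∀

  -- Since 4t, 4t' ≥ 7K − 1, the left sides give 4(2(t + 2) + (t' + 1)) ≥ 21K + 17,
  -- while the right sides give at most 4(3K + 2(K + 1)) = 20K + 8.
  slack-budget-exceeded : ∀ {K t t' m m'} → m + m' ≡ K + 1 →
    t + 2 ≤ K + m → t' + 1 ≤ K + (m' + m') →
    7 * K ≤ 4 * t + 1 → 7 * K ≤ 4 * t' + 1 → ⊥
  slack-budget-exceeded {K} {t} {t'} {m} {m'} m+m' slackₜ slackₜ' largeₜ largeₜ' =
    contradiction (≤-trans (m≤n+m 9 K) (+-cancelˡ-≤ (20 * K + 8) _ _ (begin
      20 * K + 8 + (K + 9)                    ≡⟨ regroup₁ K ⟩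
      2 * (7 * K) + 7 * K + 17                ≤⟨ +-monoˡ-≤ 17 (+-mono-≤ (*-monoʳ-≤ 2 largeₜ) largeₜ') ⟩
      2 * (4 * t + 1) + (4 * t' + 1) + 17     ≡⟨ regroup₂ t t' ⟩
      4 * (2 * (t + 2) + (t' + 1))            ≤⟨ *-monoʳ-≤ 4 (+-mono-≤ (*-monoʳ-≤ 2 slackₜ) slackₜ') ⟩
      4 * (2 * (K + m) + (K + (m' + m')))     ≡⟨ regroup₃ K m m' ⟩
      4 * (3 * K + 2 * (m + m'))              ≡⟨ cong (λ z → 4 * (3 * K + 2 * z)) m+m' ⟩
      4 * (3 * K + 2 * (K + 1))               ≡⟨ regroup₄ K ⟩
      20 * K + 8 + 0                          ∎))) λ ()
    where
    open ≤-Reasoning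
    regroup₁ : ∀ K → 20 * K + 8 + (K + 9) ≡ 2 * (7 * K) + 7 * K + 17
    regroup₁ = solve-∀
    regroup₂ : ∀ t t' → 2 * (4 * t + 1) + (4 * t' + 1) + 17 ≡ 4 * (2 * (t + 2) + (t' + 1))
    regroup₂ = solve-∀
    regroup₃ : ∀ K m m' → 4 * (2 * (K + m) + (K + (m' + m'))) ≡ 4 * (3 * K + 2 * (m + m'))
    regroup₃ = solve-∀
    regroup₄ : ∀ K → 4 * (3 * K + 2 * (K + 1)) ≡ 20 * K + 8 + 0
    regroup₄ = solve-∀

module ColourDegrees where

  open import Defs hiding (sym)
  open import Data.Nat hiding (_≟_)
  open import Data.Nat.Properties hiding (_≟_)
  open import Data.Bool using (Bool; true; false; _∧_; if_then_else_)
  open import Data.Bool.Properties using (∧-zeroʳ)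
  open import Data.Fin using (Fin)
  open import Data.Fin.Permutation.Components using (transpose)
  open import Data.Product using (_×_; _,_)
  open import Relation.Binary.PropositionalEquality
  open FinEquality
  open FiniteSums

  module _ {n : ℕ} (G : Graph n) where

    deg : Fin n → ℕ
    deg x = ∑[ y < n ] 𝟙 (adj G x y)

    degree≡deg : ∀ x → degree G x ≡ deg x
    degree≡deg x = length-filter-allFin (adj G x)

  module _ {n : ℕ} (G : Graph n) {l : ℕ} where

    cdeg : EdgeColouring G l → Fin l → Fin n → ℕ
    cdeg c b x = ∑[ y < n ] 𝟙 (adj G x y ∧ colour c x y == b)

    colourDegree≡cdeg : ∀ c b x → colourDegree c b x ≡ cdeg c b x
    colourDegree≡cdeg c b x = length-filter-allFin (λ y → adj G x y ∧ colour c x y == b)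

    ∑-cdeg : ∀ c x → ∑[ b < l ] cdeg c b x ≡ deg G x
    ∑-cdeg c x = trans (∑-comm (λ b y → 𝟙 (adj G x y ∧ colour c x y == b)))
                       (sum-cong-≗ λ y → ∑-𝟙-∧-== (adj G x y) (colour c x y))
      where
      ∑-𝟙-∧-== : ∀ A a → ∑[ b < l ] 𝟙 (A ∧ a == b) ≡ 𝟙 A
      ∑-𝟙-∧-== true a = sum-𝟙-== a
      ∑-𝟙-∧-== false a = sum-zero l

    potential : (Fin n → ℕ → ℕ) → EdgeColouring G l → ℕ
    potential g c = ∑[ x < n ] ∑[ b < l ] g x (cdeg c b x)

    module _ {c c' : EdgeColouring G l} {i j : Fin l} (i≢j : i ≢ j)
             (agree : ∀ b x → b ≢ i → b ≢ j → cdeg c' b x ≡ cdeg c b x)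
             (g : Fin n → ℕ → ℕ) where

      private
        pair : EdgeColouring G l → Fin n → ℕ
        pair d x = g x (cdeg d i x) + g x (cdeg d j x)

        exchange : ∀ x → ∑[ b < l ] g x (cdeg c' b x) + pair c x ≡ ∑[ b < l ] g x (cdeg c b x) + pair c' x
        exchange x = sum-update₂ (λ b → g x (cdeg c b x)) (λ b → g x (cdeg c' b x)) i j i≢j
                       (λ b b≢i b≢j → cong (g x) (agree b x b≢i b≢j))

        cancel-≤ : ∀ {X' X p' p} → X' + p ≡ X + p' → p' ≤ p → X' ≤ X
        cancel-≤ {X'} {X} {p'} {p} eq p'≤p = +-cancelʳ-≤ p X' X (≤-trans (≤-reflexive eq) (+-monoʳ-≤ X p'≤p))

        cancel-< : ∀ {X' X p' p} → X' + p ≡ X + p' → p' < p → X' < X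
        cancel-< {X'} {X} {p'} {p} eq p'<p = +-cancelʳ-< p X' X (≤-<-trans (≤-reflexive eq) (+-monoʳ-< X p'<p))

      module _ (pair≤ : ∀ x → pair c' x ≤ pair c x) where

        potential-mono-≤ : potential g c' ≤ potential g c
        potential-mono-≤ = sum-mono-≤ λ x → cancel-≤ (exchange x) (pair≤ x)

        potential-mono-< : ∀ v → pair c' v < pair c v → potential g c' < potential g c
        potential-mono-< v pair< = sum-mono-< (λ x → cancel-≤ (exchange x) (pair≤ x)) v (cancel-< (exchange v) pair<)

    module Recolour (c : EdgeColouring G l) where

      cdegIn : (Fin n → Fin n → Bool) → Fin l → Fin n → ℕ
      cdegIn U b x = ∑[ y < n ] 𝟙 (U x y ∧ (adj G x y ∧ colour c x y == b))

      cdegIn≤cdeg : ∀ U b x → cdegIn U b x ≤ cdeg c b x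
      cdegIn≤cdeg U b x = sum-mono-≤ λ y → 𝟙-∧-≤ (U x y) (adj G x y ∧ colour c x y == b)
        where
        𝟙-∧-≤ : ∀ u A → 𝟙 (u ∧ A) ≤ 𝟙 A
        𝟙-∧-≤ true A = ≤-refl
        𝟙-∧-≤ false A = z≤n

      cdeg≡cdegIn : ∀ U b x → (∀ y → adj G x y ≡ true → colour c x y ≡ b → U x y ≡ true) →
        cdeg c b x ≡ cdegIn U b x
      cdeg≡cdegIn U b x covered = sum-cong-≗ pointwise
        where
        pointwise : ∀ y → 𝟙 (adj G x y ∧ colour c x y == b) ≡ 𝟙 (U x y ∧ (adj G x y ∧ colour c x y == b))
        pointwise y with adj G x y in xy | colour c x y == b in col
        ... | false | _ rewrite ∧-zeroʳ (U x y) = refl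
        ... | true | false rewrite ∧-zeroʳ (U x y) = refl
        ... | true | true rewrite covered y xy (==⇒≡ col) = refl

      recolour : (i j : Fin l) (U : Fin n → Fin n → Bool) → (∀ x y → U x y ≡ U y x) → EdgeColouring G l
      recolour i j U U-sym = record
        { colour = λ x y → if U x y then transpose i j (colour c x y) else colour c x y
        ; colour-sym = λ x y xy → cong₂ (λ u a → if u then transpose i j a else a) (U-sym x y) (colour-sym c x y xy)
        }

      module _ (i j : Fin l) (U : Fin n → Fin n → Bool) (U-sym : ∀ x y → U x y ≡ U y x) where

        private
          c' = recolour i j U U-sym

        cdeg-recolour : ∀ b x → cdeg c' b x + cdegIn U b x ≡ cdeg c b x + cdegIn U (transpose j i b) x
        cdeg-recolour b x = begin
          cdeg c' b x + cdegIn U b x                     ≡⟨ ∑-distrib-+ (counts c') (countsIn b) ⟨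
          ∑[ y < n ] (counts c' y + countsIn b y)         ≡⟨ sum-cong-≗ (λ y → pointwise (U x y) (adj G x y) (colour c x y)) ⟩
          ∑[ y < n ] (counts c y + countsIn (transpose j i b) y) ≡⟨ ∑-distrib-+ (counts c) (countsIn (transpose j i b)) ⟩
          cdeg c b x + cdegIn U (transpose j i b) x      ∎
          where
          open ≡-Reasoning
          counts : EdgeColouring G l → Fin n → ℕ
          counts d y = 𝟙 (adj G x y ∧ colour d x y == b)
          countsIn : Fin l → Fin n → ℕ
          countsIn β y = 𝟙 (U x y ∧ (adj G x y ∧ colour c x y == β))
          pointwise : ∀ u A a → 𝟙 (A ∧ (if u then transpose i j a else a) == b) + 𝟙 (u ∧ (A ∧ a == b))
                              ≡ 𝟙 (A ∧ a == b) + 𝟙 (u ∧ (A ∧ a == transpose j i b))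
          pointwise true A a rewrite transpose-== i j a b = +-comm (𝟙 (A ∧ a == transpose j i b)) _
          pointwise false A a = refl

        recolour-shift : ∀ {a b} d x → transpose j i a ≡ b → transpose j i b ≡ a →
          cdegIn U a x ≡ d + cdegIn U b x → cdeg c a x ≡ d + cdeg c' a x × cdeg c' b x ≡ d + cdeg c b x
        recolour-shift {a} {b} d x τa τb Ua≡d+Ub =
            +-cancelʳ-≡ (cdegIn U b x) _ _ (begin
              cdeg c a x + cdegIn U b x       ≡⟨ cong (λ β → cdeg c a x + cdegIn U β x) τa ⟨
              cdeg c a x + cdegIn U (transpose j i a) x ≡⟨ cdeg-recolour a x ⟨
              cdeg c' a x + cdegIn U a x      ≡⟨ cong (cdeg c' a x +_) Ua≡d+Ub ⟩
              cdeg c' a x + (d + cdegIn U b x) ≡⟨ regroup (cdeg c' a x) d _ ⟩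
              d + cdeg c' a x + cdegIn U b x  ∎)
          , +-cancelʳ-≡ (cdegIn U b x) _ _ (begin
              cdeg c' b x + cdegIn U b x      ≡⟨ cdeg-recolour b x ⟩
              cdeg c b x + cdegIn U (transpose j i b) x ≡⟨ cong (λ β → cdeg c b x + cdegIn U β x) τb ⟩
              cdeg c b x + cdegIn U a x       ≡⟨ cong (cdeg c b x +_) Ua≡d+Ub ⟩
              cdeg c b x + (d + cdegIn U b x) ≡⟨ regroup (cdeg c b x) d _ ⟩
              d + cdeg c b x + cdegIn U b x   ∎)
          where
          open ≡-Reasoning
          regroup : ∀ p d q → p + (d + q) ≡ d + p + q
          regroup p d q = trans (sym (+-assoc p d q)) (cong (_+ q) (+-comm p d))

        recolour-agree : ∀ b x → b ≢ i → b ≢ j → cdeg c' b x ≡ cdeg c b x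
        recolour-agree b x b≢i b≢j = +-cancelʳ-≡ (cdegIn U b x) _ _
          (trans (cdeg-recolour b x) (cong (λ β → cdeg c b x + cdegIn U β x) (transpose-other b≢j b≢i)))

module AlternatingTrails where

  open import Defs renaming (sym to adj-sym)
  open import Data.Nat hiding (_≟_)
  open import Data.Nat.Properties hiding (_≟_)
  open import Data.Bool using (Bool; true; false; _∧_; _∨_; not)
  import Data.Bool as Bool
  open import Data.Bool.Properties using (∨-identityʳ; ∨-comm; ∧-comm)
  open import Data.Fin using (Fin)
  open import Data.Fin.Permutation.Components using (transpose)
  open import Data.Fin.Properties using (_≟_; any?)
  open import Data.Product using (Σ; _×_; _,_; proj₁; proj₂)
  open import Relation.Binary.PropositionalEquality
  open import Relation.Nullary using (Dec; yes; no; contradiction)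
  open import Relation.Nullary.Decidable using (_×-dec_)
  open import Data.Nat.Tactic.RingSolver using (solve-∀)
  open FinEquality
  open FiniteSums
  open ColourDegrees
  open Convexity

  module _ {n : ℕ} {G : Graph n} {l : ℕ} (c : EdgeColouring G l) where

    open Recolour G c

    adj⇒≢ : ∀ {x y} → adj G x y ≡ true → x ≢ y
    adj⇒≢ {x} xy refl = contradiction (trans (sym xy) (irrefl G x)) λ ()

    addEdge : (Fin n → Fin n → Bool) → Fin n → Fin n → Fin n → Fin n → Bool
    addEdge U p q x y = U x y ∨ ((x == p ∧ y == q) ∨ (x == q ∧ y == p))

    addEdge-comm : ∀ U p q x y → addEdge U p q x y ≡ addEdge U q p x y
    addEdge-comm U p q x y = cong (U x y ∨_) (∨-comm (x == p ∧ y == q) _)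

    addEdge-sym : ∀ {U} → (∀ x y → U x y ≡ U y x) → ∀ p q x y → addEdge U p q x y ≡ addEdge U p q y x
    addEdge-sym {U} U-sym p q x y = cong₂ _∨_ (U-sym x y)
      (trans (∨-comm (x == p ∧ y == q) _) (cong₂ _∨_ (∧-comm (x == q) _) (∧-comm (x == p) _)))

    module _ {U : Fin n → Fin n → Bool} {p q : Fin n} (pq : adj G p q ≡ true) (Upq : U p q ≡ false) where

      cdegIn-addEdge-source : ∀ b → cdegIn (addEdge U p q) b p ≡ cdegIn U b p + 𝟙 (colour c p q == b)
      cdegIn-addEdge-source b = begin
        cdegIn (addEdge U p q) b p     ≡⟨ +-identityʳ _ ⟨
        cdegIn (addEdge U p q) b p + 0 ≡⟨ cong (cdegIn (addEdge U p q) b p +_) (cong (λ u → 𝟙 (u ∧ _)) Upq) ⟨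
        cdegIn (addEdge U p q) b p + counts U q ≡⟨ sum-update (counts U) (counts (addEdge U p q)) q unchanged ⟩
        cdegIn U b p + counts (addEdge U p q) q ≡⟨ cong (cdegIn U b p +_) new ⟩
        cdegIn U b p + 𝟙 (colour c p q == b) ∎
        where
        open ≡-Reasoning
        counts : (Fin n → Fin n → Bool) → Fin n → ℕ
        counts W y = 𝟙 (W p y ∧ (adj G p y ∧ colour c p y == b))
        unchanged : ∀ y → y ≢ q → counts (addEdge U p q) y ≡ counts U y
        unchanged y y≢q rewrite ==-refl p | ==-≢ y≢q | ==-≢ (adj⇒≢ pq) | ∨-identityʳ (U p y) = refl
        new : counts (addEdge U p q) q ≡ 𝟙 (colour c p q == b)
        new rewrite Upq | ==-refl p | ==-refl q | pq = refl

    cdegIn-addEdge-away : ∀ U {p q x} b → x ≢ p → x ≢ q → cdegIn (addEdge U p q) b x ≡ cdegIn U b x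
    cdegIn-addEdge-away U {p} {q} {x} b x≢p x≢q = sum-cong-≗ λ y → cong (λ u → 𝟙 (u ∧ _)) (not-added y)
      where
      not-added : ∀ y → addEdge U p q x y ≡ U x y
      not-added y rewrite ==-≢ x≢p | ==-≢ x≢q = ∨-identityʳ (U x y)

    private
      +-comm-unit : ∀ a k → a + k ≡ 1 * k + a
      +-comm-unit a k = trans (+-comm a k) (cong (_+ a) (sym (*-identityˡ k)))

      indicators : ∀ {n} {x p q : Fin n} {β γ} k m → (x == p) ≡ β → (x == q) ≡ γ →
        (𝟙 (x == p) + 𝟙 (x == q)) * k + m ≡ (𝟙 β + 𝟙 γ) * k + m
      indicators k m refl refl = refl

    module _ {U : Fin n → Fin n → Bool} (U-sym : ∀ x y → U x y ≡ U y x)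
             {p q : Fin n} (pq : adj G p q ≡ true) (Upq : U p q ≡ false) where

      cdegIn-addEdge : ∀ b x →
        cdegIn (addEdge U p q) b x ≡ (𝟙 (x == p) + 𝟙 (x == q)) * 𝟙 (colour c p q == b) + cdegIn U b x
      cdegIn-addEdge b x = by-cases x (x ≟ p) (x ≟ q)
        where
        open ≡-Reasoning
        by-cases : ∀ x → Dec (x ≡ p) → Dec (x ≡ q) →
          cdegIn (addEdge U p q) b x ≡ (𝟙 (x == p) + 𝟙 (x == q)) * 𝟙 (colour c p q == b) + cdegIn U b x
        by-cases x (yes refl) _ = begin
          cdegIn (addEdge U x q) b x      ≡⟨ cdegIn-addEdge-source {U = U} pq Upq b ⟩
          cdegIn U b x + k                ≡⟨ +-comm-unit (cdegIn U b x) k ⟩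
          1 * k + cdegIn U b x            ≡⟨ indicators k _ (==-refl x) (==-≢ (adj⇒≢ pq)) ⟨
          (𝟙 (x == x) + 𝟙 (x == q)) * k + cdegIn U b x ∎
          where k = 𝟙 (colour c x q == b)
        by-cases x (no x≢p) (yes refl) = begin
          cdegIn (addEdge U p x) b x      ≡⟨ sum-cong-≗ (λ y → cong (λ u → 𝟙 (u ∧ _)) (addEdge-comm U p x x y)) ⟩
          cdegIn (addEdge U x p) b x      ≡⟨ cdegIn-addEdge-source {U = U} xp (trans (U-sym x p) Upq) b ⟩
          cdegIn U b x + 𝟙 (colour c x p == b) ≡⟨ cong (λ a → cdegIn U b x + 𝟙 (a == b)) (colour-sym c x p xp) ⟩
          cdegIn U b x + k                ≡⟨ +-comm-unit (cdegIn U b x) k ⟩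
          1 * k + cdegIn U b x            ≡⟨ indicators k _ (==-≢ x≢p) (==-refl x) ⟨
          (𝟙 (x == p) + 𝟙 (x == x)) * k + cdegIn U b x ∎
          where
          k = 𝟙 (colour c p x == b)
          xp : adj G x p ≡ true
          xp = trans (adj-sym G x p) pq
        by-cases x (no x≢p) (no x≢q) = begin
          cdegIn (addEdge U p q) b x      ≡⟨ cdegIn-addEdge-away U b x≢p x≢q ⟩
          cdegIn U b x                    ≡⟨ indicators (𝟙 (colour c p q == b)) _ (==-≢ x≢p) (==-≢ x≢q) ⟨
          (𝟙 (x == p) + 𝟙 (x == q)) * 𝟙 (colour c p q == b) + cdegIn U b x ∎

    unused : (Fin n → Fin n → Bool) → ℕ
    unused U = ∑[ x < n ] ∑[ y < n ] 𝟙 (adj G x y ∧ not (U x y))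

    unused-addEdge : ∀ U {p q} → adj G p q ≡ true → U p q ≡ false → unused (addEdge U p q) < unused U
    unused-addEdge U {p} {q} pq Upq =
      sum-mono-< (λ x → sum-mono-≤ (λ y → 𝟙-mono (adj G x y) (U x y) _)) p
        (sum-mono-< (λ y → 𝟙-mono (adj G p y) (U p y) _) q newly-used)
      where
      𝟙-mono : ∀ A u w → 𝟙 (A ∧ not (u ∨ w)) ≤ 𝟙 (A ∧ not u)
      𝟙-mono false u w = z≤n
      𝟙-mono true true w = z≤n
      𝟙-mono true false true = z≤n
      𝟙-mono true false false = ≤-refl
      newly-used : 𝟙 (adj G p q ∧ not (addEdge U p q p q)) < 𝟙 (adj G p q ∧ not (U p q))
      newly-used rewrite pq | Upq | ==-refl p | ==-refl q = z<s

    module _ {i j : Fin l} (i≢j : i ≢ j) where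

      nextColour : Bool → Fin l
      nextColour true = i
      nextColour false = j

      -- The parity is that of the number of edges of a trail from v to w.
      Balanced : (Fin n → Fin n → Bool) → Fin n → Fin n → Bool → Set
      Balanced U v w true = ∀ x → 𝟙 (x == w) + cdegIn U i x ≡ 𝟙 (x == v) + cdegIn U j x
      Balanced U v w false = ∀ x → cdegIn U i x ≡ 𝟙 (x == v) + 𝟙 (x == w) + cdegIn U j x

      record AlternatingTrail (v : Fin n) : Set where
        constructor trail
        field
          edges : Fin n → Fin n → Bool
          edges-sym : ∀ x y → edges x y ≡ edges y x
          end : Fin n
          even : Bool
          balanced : Balanced edges v end even

      open AlternatingTrail public

      Maximal : ∀ {v} → AlternatingTrail v → Set
      Maximal t = ∀ y → adj G (end t) y ≡ true → colour c (end t) y ≡ nextColour (even t) → edges t (end t) y ≡ true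

      emptyTrail : ∀ v → AlternatingTrail v
      emptyTrail v = trail (λ _ _ → false) (λ _ _ → refl) v true (λ _ → refl)

      private
        cdegIn-addEdge-match : ∀ {U} → (∀ x y → U x y ≡ U y x) → ∀ {p q} → adj G p q ≡ true → U p q ≡ false →
          ∀ {b} → colour c p q ≡ b → ∀ x → cdegIn (addEdge U p q) b x ≡ 𝟙 (x == p) + 𝟙 (x == q) + cdegIn U b x
        cdegIn-addEdge-match {U} U-sym {p} {q} pq Upq {b} refl x = begin
          cdegIn (addEdge U p q) b x              ≡⟨ cdegIn-addEdge U-sym pq Upq b x ⟩
          (𝟙 (x == p) + 𝟙 (x == q)) * 𝟙 (b == b) + cdegIn U b x
                                                  ≡⟨ cong (λ β → (𝟙 (x == p) + 𝟙 (x == q)) * 𝟙 β + cdegIn U b x) (==-refl b) ⟩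
          (𝟙 (x == p) + 𝟙 (x == q)) * 1 + cdegIn U b x ≡⟨ cong (_+ cdegIn U b x) (*-identityʳ _) ⟩
          𝟙 (x == p) + 𝟙 (x == q) + cdegIn U b x  ∎
          where open ≡-Reasoning

        cdegIn-addEdge-mismatch : ∀ {U} → (∀ x y → U x y ≡ U y x) → ∀ {p q} → adj G p q ≡ true → U p q ≡ false →
          ∀ {b} → colour c p q ≢ b → ∀ x → cdegIn (addEdge U p q) b x ≡ cdegIn U b x
        cdegIn-addEdge-mismatch {U} U-sym {p} {q} pq Upq {b} col≢b x = begin
          cdegIn (addEdge U p q) b x              ≡⟨ cdegIn-addEdge U-sym pq Upq b x ⟩
          (𝟙 (x == p) + 𝟙 (x == q)) * 𝟙 (colour c p q == b) + cdegIn U b x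
                                                  ≡⟨ cong (λ β → (𝟙 (x == p) + 𝟙 (x == q)) * 𝟙 β + cdegIn U b x) (==-≢ col≢b) ⟩
          (𝟙 (x == p) + 𝟙 (x == q)) * 0 + cdegIn U b x ≡⟨ cong (_+ cdegIn U b x) (*-zeroʳ (𝟙 (x == p) + 𝟙 (x == q))) ⟩
          cdegIn U b x                            ∎
          where open ≡-Reasoning

      extend-balanced : ∀ {v U w} → (∀ x y → U x y ≡ U y x) → ∀ parity → Balanced U v w parity →
        ∀ {y} → adj G w y ≡ true → U w y ≡ false → colour c w y ≡ nextColour parity →
        Balanced (addEdge U w y) v y (not parity)
      extend-balanced {v} {U} {w} U-sym true bal {y} wy Uwy col x
        rewrite cdegIn-addEdge-match U-sym wy Uwy col x
              | cdegIn-addEdge-mismatch U-sym wy Uwy (λ col≡j → i≢j (trans (sym col) col≡j)) x = begin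
        𝟙 (x == w) + 𝟙 (x == y) + cdegIn U i x   ≡⟨ regroup (𝟙 (x == w)) _ _ ⟩
        𝟙 (x == y) + (𝟙 (x == w) + cdegIn U i x) ≡⟨ cong (𝟙 (x == y) +_) (bal x) ⟩
        𝟙 (x == y) + (𝟙 (x == v) + cdegIn U j x) ≡⟨ regroup (𝟙 (x == v)) _ _ ⟨
        𝟙 (x == v) + 𝟙 (x == y) + cdegIn U j x   ∎
        where
        open ≡-Reasoning
        regroup : ∀ a b m → a + b + m ≡ b + (a + m)
        regroup = solve-∀
      extend-balanced {v} {U} {w} U-sym false bal {y} wy Uwy col x
        rewrite cdegIn-addEdge-match U-sym wy Uwy col x
              | cdegIn-addEdge-mismatch U-sym wy Uwy (λ col≡i → i≢j (trans (sym col≡i) col)) x = begin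
        𝟙 (x == y) + cdegIn U i x                             ≡⟨ cong (𝟙 (x == y) +_) (bal x) ⟩
        𝟙 (x == y) + (𝟙 (x == v) + 𝟙 (x == w) + cdegIn U j x) ≡⟨ regroup (𝟙 (x == y)) (𝟙 (x == v)) _ _ ⟩
        𝟙 (x == v) + (𝟙 (x == w) + 𝟙 (x == y) + cdegIn U j x) ∎
        where
        open ≡-Reasoning
        regroup : ∀ a b d m → a + (b + d + m) ≡ b + (d + a + m)
        regroup = solve-∀

      extend : ∀ {v} (t : AlternatingTrail v) {y} → adj G (end t) y ≡ true → edges t (end t) y ≡ false →
        colour c (end t) y ≡ nextColour (even t) → AlternatingTrail v
      extend t {y} wy unused-wy col = record
        { edges = addEdge (edges t) (end t) y
        ; edges-sym = addEdge-sym (edges-sym t) (end t) y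
        ; end = y
        ; even = not (even t)
        ; balanced = extend-balanced (edges-sym t) (even t) (balanced t) wy unused-wy col
        }

      maximise : ∀ {v} fuel (t : AlternatingTrail v) → unused (edges t) < fuel → Σ (AlternatingTrail v) Maximal
      maximise (suc fuel) t bound
        with any? (λ y → (adj G (end t) y Bool.≟ true) ×-dec (edges t (end t) y Bool.≟ false)
                           ×-dec (colour c (end t) y ≟ nextColour (even t)))
      ... | yes (y , wy , unused-wy , col) =
        maximise fuel (extend t wy unused-wy col) (≤-trans (unused-addEdge (edges t) wy unused-wy) (≤-pred bound))
      ... | no stuck = t , maximal
        where
        maximal : Maximal t
        maximal y wy col with edges t (end t) y in e
        ... | true = refl
        ... | false = contradiction (y , wy , e , col) stuck

      maximalTrail : ∀ v → Σ (AlternatingTrail v) Maximal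
      maximalTrail v = maximise (suc (unused (λ _ _ → false))) (emptyTrail v) ≤-refl

      evenBalance-at : ∀ U {v w} → Balanced U v w true → ∀ x {p q} → (x == w) ≡ p → (x == v) ≡ q →
        𝟙 p + cdegIn U i x ≡ 𝟙 q + cdegIn U j x
      evenBalance-at U bal x refl refl = bal x

      oddBalance-at : ∀ U {v w} → Balanced U v w false → ∀ x {p q} → (x == v) ≡ p → (x == w) ≡ q →
        cdegIn U i x ≡ 𝟙 p + 𝟙 q + cdegIn U j x
      oddBalance-at U bal x refl refl = bal x

      NoWorse : EdgeColouring G l → Set
      NoWorse d = ∀ g → (∀ x → Convex (g x)) → potential G g d ≤ potential G g c

      Rebalanced : Set
      Rebalanced = Σ (EdgeColouring G l) λ d → NoWorse d × potential G (λ _ → square) d < potential G (λ _ → square) c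

      module Swapped {U : Fin n → Fin n → Bool} (U-sym : ∀ x y → U x y ≡ U y x) where

        c' : EdgeColouring G l
        c' = recolour i j U U-sym

        shiftᵢⱼ : ∀ d x → cdegIn U i x ≡ d + cdegIn U j x →
          cdeg G c i x ≡ d + cdeg G c' i x × cdeg G c' j x ≡ d + cdeg G c j x
        shiftᵢⱼ d x = recolour-shift i j U U-sym d x (transpose-right j i) (transpose-left j i)

        shiftⱼᵢ : ∀ d x → cdegIn U j x ≡ d + cdegIn U i x →
          cdeg G c j x ≡ d + cdeg G c' j x × cdeg G c' i x ≡ d + cdeg G c i x
        shiftⱼᵢ d x = recolour-shift i j U U-sym d x (transpose-left j i) (transpose-right j i)

        unchanged : ∀ x → cdegIn U i x ≡ cdegIn U j x → (g : ℕ → ℕ) →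
          g (cdeg G c' i x) + g (cdeg G c' j x) ≡ g (cdeg G c i x) + g (cdeg G c j x)
        unchanged x I≡J g = cong₂ (λ a b → g a + g b) (sym (proj₁ shifted)) (proj₂ shifted)
          where
          shifted = shiftᵢⱼ 0 x I≡J

        agree : ∀ b x → b ≢ i → b ≢ j → cdeg G c' b x ≡ cdeg G c b x
        agree = recolour-agree i j U U-sym

        Improves : Fin n → Set
        Improves x = ∀ g → Convex g → g (cdeg G c' i x) + g (cdeg G c' j x) ≤ g (cdeg G c i x) + g (cdeg G c j x)

        rebalanced : (∀ x → Improves x) → ∀ v →
          square (cdeg G c' i v) + square (cdeg G c' j v) < square (cdeg G c i v) + square (cdeg G c j v) →
          Rebalanced
        rebalanced improves v fewer = c'
          , (λ g convex → potential-mono-≤ G {c = c} {c' = c'} i≢j agree g (λ x → improves x (g x) (convex x)))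
          , potential-mono-< G {c = c} {c' = c'} i≢j agree (λ _ → square) (λ x → improves x square square-convex) v fewer

      closedEvenTrail-i≤j : ∀ {U v} → Balanced U v v true →
        (∀ y → adj G v y ≡ true → colour c v y ≡ i → U v y ≡ true) → cdeg G c i v ≤ cdeg G c j v
      closedEvenTrail-i≤j {U} {v} bal maximal = begin
        cdeg G c i v  ≡⟨ cdeg≡cdegIn U i v maximal ⟩
        cdegIn U i v  ≡⟨ suc-injective (evenBalance-at U bal v (==-refl v) (==-refl v)) ⟩
        cdegIn U j v  ≤⟨ cdegIn≤cdeg U j v ⟩
        cdeg G c j v  ∎
        where open ≤-Reasoning

      openEvenTrail-rebalances : ∀ {U} (U-sym : ∀ x y → U x y ≡ U y x) {v w} → Balanced U v w true →
        (∀ y → adj G w y ≡ true → colour c w y ≡ i → U w y ≡ true) → v ≢ w →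
        2 + cdeg G c j v < cdeg G c i v → Rebalanced
      openEvenTrail-rebalances {U} U-sym {v} {w} bal maximal v≢w gap =
        rebalanced improves v (square-transfer-< (proj₁ at-v) (proj₂ at-v) (≤-<-trans (m≤n+m _ 1) gap))
        where
        open Swapped U-sym
        at-v = shiftᵢⱼ 1 v (evenBalance-at U bal v (==-≢ v≢w) (==-refl v))
        improves : ∀ x → Improves x
        improves x = by-cases x (x ≟ v) (x ≟ w)
          where
          by-cases : ∀ x → Dec (x ≡ v) → Dec (x ≡ w) → Improves x
          by-cases x (yes refl) _ g convex = convex-transferʳ {g = g} convex (proj₁ at-v) (proj₂ at-v) (≤-<-trans (m≤n+m _ 2) gap)
          by-cases x (no x≢v) (yes refl) g convex = convex-transferˡ {g = g} convex (proj₁ at-w) (proj₂ at-w) i<j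
            where
            J≡1+I = sym (evenBalance-at U bal x (==-refl x) (==-≢ x≢v))
            at-w = shiftⱼᵢ 1 x J≡1+I
            i<j : cdeg G c i x < cdeg G c j x
            i<j = begin-strict
              cdeg G c i x  ≡⟨ cdeg≡cdegIn U i x maximal ⟩
              cdegIn U i x  <⟨ ≤-reflexive (sym J≡1+I) ⟩
              cdegIn U j x  ≤⟨ cdegIn≤cdeg U j x ⟩
              cdeg G c j x  ∎
              where open ≤-Reasoning
          by-cases x (no x≢v) (no x≢w) g _ = ≤-reflexive (unchanged x (evenBalance-at U bal x (==-≢ x≢w) (==-≢ x≢v)) g)

      closedOddTrail-rebalances : ∀ {U} (U-sym : ∀ x y → U x y ≡ U y x) {v} → Balanced U v v false →
        2 + cdeg G c j v < cdeg G c i v → Rebalanced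
      closedOddTrail-rebalances {U} U-sym {v} bal gap =
        rebalanced improves v (square-transfer₂-< (proj₁ at-v) (proj₂ at-v) gap)
        where
        open Swapped U-sym
        at-v = shiftᵢⱼ 2 v (oddBalance-at U bal v (==-refl v) (==-refl v))
        improves : ∀ x → Improves x
        improves x = by-cases x (x ≟ v)
          where
          by-cases : ∀ x → Dec (x ≡ v) → Improves x
          by-cases x (yes refl) g convex = convex-transferʳ₂ {g = g} convex (proj₁ at-v) (proj₂ at-v) gap
          by-cases x (no x≢v) g _ = ≤-reflexive (unchanged x (oddBalance-at U bal x (==-≢ x≢v) (==-≢ x≢v)) g)

      openOddTrail-rebalances : ∀ {U} (U-sym : ∀ x y → U x y ≡ U y x) {v w} → Balanced U v w false →
        (∀ y → adj G w y ≡ true → colour c w y ≡ j → U w y ≡ true) → v ≢ w →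
        2 + cdeg G c j v < cdeg G c i v → Rebalanced
      openOddTrail-rebalances {U} U-sym {v} {w} bal maximal v≢w gap =
        rebalanced improves v (square-transfer-< (proj₁ at-v) (proj₂ at-v) (≤-<-trans (m≤n+m _ 1) gap))
        where
        open Swapped U-sym
        at-v = shiftᵢⱼ 1 v (oddBalance-at U bal v (==-refl v) (==-≢ v≢w))
        improves : ∀ x → Improves x
        improves x = by-cases x (x ≟ v) (x ≟ w)
          where
          by-cases : ∀ x → Dec (x ≡ v) → Dec (x ≡ w) → Improves x
          by-cases x (yes refl) _ g convex = convex-transferʳ {g = g} convex (proj₁ at-v) (proj₂ at-v) (≤-<-trans (m≤n+m _ 2) gap)
          by-cases x (no x≢v) (yes refl) g convex = convex-transferʳ {g = g} convex (proj₁ at-w) (proj₂ at-w) j<i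
            where
            I≡1+J = oddBalance-at U bal x (==-≢ x≢v) (==-refl x)
            at-w = shiftᵢⱼ 1 x I≡1+J
            j<i : cdeg G c j x < cdeg G c i x
            j<i = begin-strict
              cdeg G c j x  ≡⟨ cdeg≡cdegIn U j x maximal ⟩
              cdegIn U j x  <⟨ ≤-reflexive (sym I≡1+J) ⟩
              cdegIn U i x  ≤⟨ cdegIn≤cdeg U i x ⟩
              cdeg G c i x  ∎
              where open ≤-Reasoning
          by-cases x (no x≢v) (no x≢w) g _ = ≤-reflexive (unchanged x (oddBalance-at U bal x (==-≢ x≢v) (==-≢ x≢w)) g)

      rebalance : ∀ v → 2 + cdeg G c j v < cdeg G c i v → Rebalanced
      rebalance v gap with maximalTrail v
      ... | trail U U-sym w true bal , maximal with v ≟ w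
      ...   | yes refl = contradiction (closedEvenTrail-i≤j {U} bal maximal) (<⇒≱ (≤-<-trans (m≤n+m _ 2) gap))
      ...   | no v≢w = openEvenTrail-rebalances U-sym bal maximal v≢w gap
      rebalance v gap | trail U U-sym w false bal , maximal with v ≟ w
      ...   | yes refl = closedOddTrail-rebalances U-sym bal gap
      ...   | no v≢w = openOddTrail-rebalances U-sym bal maximal v≢w gap

      recolourEdge : ∀ (T : Fin n → ℕ) {v u} → adj G v u ≡ true → colour c v u ≡ i →
        T v < cdeg G c i v → cdeg G c j v < T v → cdeg G c j u < T u →
        Σ (EdgeColouring G l) λ d → potential G (λ x a → a ∸ T x) d < potential G (λ x a → a ∸ T x) c
      recolourEdge T {v} {u} vu col over-v under-v under-u =
        c' , potential-mono-< G {c = c} {c' = c'} i≢j agree excess (λ x → pair≤ x (x ≟ v) (x ≟ u)) v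
               (∸-transfer-across (T v) (proj₁ at-v) (proj₂ at-v) under-v over-v)
        where
        single = extend (emptyTrail v) vu refl col
        U = edges single
        open Swapped (edges-sym single)
        excess : Fin n → ℕ → ℕ
        excess x a = a ∸ T x
        at-v = shiftᵢⱼ 1 v (oddBalance-at U (balanced single) v (==-refl v) (==-≢ (adj⇒≢ vu)))
        pair≤ : ∀ x → Dec (x ≡ v) → Dec (x ≡ u) →
          excess x (cdeg G c' i x) + excess x (cdeg G c' j x) ≤ excess x (cdeg G c i x) + excess x (cdeg G c j x)
        pair≤ x (yes refl) _ = <⇒≤ (∸-transfer-across (T x) (proj₁ at-v) (proj₂ at-v) under-v over-v)
        pair≤ x (no x≢v) (yes refl) = ∸-transfer-below (T x) (proj₁ at-u) (proj₂ at-u) under-u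
          where at-u = shiftᵢⱼ 1 x (oddBalance-at U (balanced single) x (==-≢ x≢v) (==-refl x))
        pair≤ x (no x≢v) (no x≢u) =
          ≤-reflexive (unchanged x (oddBalance-at U (balanced single) x (==-≢ x≢v) (==-≢ x≢u)) (excess x))

module Balancing where

  open import Defs hiding (sym)
  open import Data.Nat hiding (_≟_)
  open import Data.Nat.Properties hiding (_≟_)
  open import Data.Nat.DivMod using (_/_)
  open import Data.Bool using (Bool; true; false; _∧_; not)
  import Data.Bool as Bool
  open import Data.Fin using (Fin; fromℕ<)
  open import Data.Fin.Properties using (_≟_; any?; all?; ¬∀⟶∃¬)
  open import Data.Product using (Σ; ∃; _,_; proj₁; proj₂)
  open import Data.Sum using (_⊎_; inj₁; inj₂)
  open import Data.Empty using (⊥)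
  open import Relation.Binary.PropositionalEquality
  open import Relation.Nullary using (yes; no; contradiction)
  open import Relation.Nullary.Decidable using (⌊_⌋; _×-dec_; toWitness)
  open import Data.Bool.Properties using (T-∧; T-≡)
  open import Function.Bundles using (Equivalence)
  open import Function using (_∘_; _on_)
  open import Induction.WellFounded using (WellFounded; Acc; acc)
  open import Data.Nat.Induction using (<-wellFounded)
  import Relation.Binary.Construct.On as On
  open import Data.Product.Relation.Binary.Lex.Strict using (×-Lex; ×-wellFounded)
  open FinEquality
  open FiniteSums
  open Convexity
  open SlackArithmetic
  open ColourDegrees
  open AlternatingTrails

  module _ {n : ℕ} (G : Graph n) (K : ℕ) .{{_ : NonZero K}} where

    target : Fin n → ℕ
    target x = deg G x / K

    MinDegree : Set
    MinDegree = ∀ x → 7 * (K * K) + 2 * K ≤ 4 * deg G x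

    Spread≤2 : EdgeColouring G (K + 1) → Set
    Spread≤2 c = ∀ x a b → cdeg G c a x ≤ 2 + cdeg G c b x

    module _ (c : EdgeColouring G (K + 1)) (v : Fin n) where

      deficient : Fin (K + 1) → Bool
      deficient b = ⌊ cdeg G c b v <? target v ⌋

      #deficient #sufficient : ℕ
      #deficient = ∑[ b < K + 1 ] 𝟙 (deficient b)
      #sufficient = ∑[ b < K + 1 ] 𝟙 (not (deficient b))

      #deficient+#sufficient : #deficient + #sufficient ≡ K + 1
      #deficient+#sufficient = begin
        #deficient + #sufficient                            ≡⟨ ∑-distrib-+ (𝟙 ∘ deficient) (𝟙 ∘ not ∘ deficient) ⟨
        ∑[ b < K + 1 ] (𝟙 (deficient b) + 𝟙 (not (deficient b))) ≡⟨ sum-cong-≗ (λ b → 𝟙+𝟙-not (deficient b)) ⟩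
        ∑[ b < K + 1 ] 1                                    ≡⟨ sum-const (K + 1) 1 ⟩
        (K + 1) * 1                                         ≡⟨ *-identityʳ (K + 1) ⟩
        K + 1                                               ∎
        where
        open ≡-Reasoning
        𝟙+𝟙-not : ∀ β → 𝟙 β + 𝟙 (not β) ≡ 1
        𝟙+𝟙-not true = refl
        𝟙+𝟙-not false = refl

      overloaded-slack : Spread≤2 c → ∀ {i} → target v < cdeg G c i v → target v + 2 ≤ K + #deficient
      overloaded-slack spread {i} over = slack K (target v) (begin
        (K + 1) * target v + 1                                 ≡⟨ cong₂ _+_ (sum-const (K + 1) (target v)) (sum-𝟙-== i) ⟨
        ∑[ b < K + 1 ] target v + ∑[ b < K + 1 ] 𝟙 (i == b)     ≡⟨ ∑-distrib-+ (λ _ → target v) (𝟙 ∘ (i ==_)) ⟨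
        ∑[ b < K + 1 ] (target v + 𝟙 (i == b))                  ≤⟨ sum-mono-≤ pointwise ⟩
        ∑[ b < K + 1 ] (cdeg G c b v + 𝟙 (deficient b))         ≡⟨ ∑-distrib-+ (λ b → cdeg G c b v) (𝟙 ∘ deficient) ⟩
        ∑[ b < K + 1 ] cdeg G c b v + #deficient                ≡⟨ cong (_+ #deficient) (∑-cdeg G c v) ⟩
        deg G v + #deficient                                    ∎) (d<K*[d/K]+K K (deg G v))
        where
        open ≤-Reasoning
        pointwise : ∀ b → target v + 𝟙 (i == b) ≤ cdeg G c b v + 𝟙 (deficient b)
        pointwise b with i ≟ b | cdeg G c b v <? target v
        ... | yes refl | _ = ≤-trans (≤-reflexive (+-comm (target v) 1)) (≤-trans over (m≤m+n _ _))
        ... | no _ | yes _ = begin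
          target v + 0       ≡⟨ +-identityʳ (target v) ⟩
          target v           ≤⟨ ≤-pred (≤-trans over (spread v i b)) ⟩
          1 + cdeg G c b v   ≡⟨ +-comm 1 _ ⟩
          cdeg G c b v + 1   ∎
        ... | no _ | no b≮t = +-monoˡ-≤ 0 (≮⇒≥ b≮t)

      neighbour-slack : Spread≤2 c → ∀ {u j₀} → cdeg G c j₀ v < target v →
        (∀ j → cdeg G c j v < target v → target u ≤ cdeg G c j u) →
        target u + 1 ≤ K + (#sufficient + #sufficient)
      neighbour-slack spread {u} {j₀} j₀-deficient saturated = slack K (target u) (begin
        (K + 1) * target u + 0                           ≡⟨ +-identityʳ _ ⟩
        (K + 1) * target u                               ≡⟨ sum-const (K + 1) (target u) ⟨
        ∑[ b < K + 1 ] target u                          ≤⟨ sum-mono-≤ pointwise ⟩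
        ∑[ b < K + 1 ] (cdeg G c b u + (sufficient b + sufficient b))
                                                         ≡⟨ ∑-distrib-+ (λ b → cdeg G c b u) (λ b → sufficient b + sufficient b) ⟩
        ∑[ b < K + 1 ] cdeg G c b u + ∑[ b < K + 1 ] (sufficient b + sufficient b)
                                                         ≡⟨ cong₂ _+_ (∑-cdeg G c u) (∑-distrib-+ sufficient sufficient) ⟩
        deg G u + (#sufficient + #sufficient)            ∎) (d<K*[d/K]+K K (deg G u))
        where
        open ≤-Reasoning
        sufficient : Fin (K + 1) → ℕ
        sufficient b = 𝟙 (not (deficient b))
        pointwise : ∀ b → target u ≤ cdeg G c b u + (sufficient b + sufficient b)
        pointwise b with cdeg G c b v <? target v
        ... | yes b-deficient = ≤-trans (saturated b b-deficient) (m≤m+n _ 0)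
        ... | no _ = ≤-trans (saturated j₀ j₀-deficient) (≤-trans (spread u j₀ b) (≤-reflexive (+-comm 2 _)))

      SaturatedNeighbours : Fin (K + 1) → Set
      SaturatedNeighbours i =
        ∀ u j → adj G v u ≡ true → colour c v u ≡ i → cdeg G c j v < target v → target u ≤ cdeg G c j u

      overload-irreparable : MinDegree → Spread≤2 c → ∀ {i} → target v < cdeg G c i v → SaturatedNeighbours i → ⊥
      overload-irreparable δ spread {i} over saturated =
        slack-budget-exceeded #deficient+#sufficient slack-v
          (neighbour-slack spread j₀-deficient (λ j → saturated u j vu col)) large-v large-u
        where
        slack-v = overloaded-slack spread over
        large-v = quotient-large K (target v) (δ v) (d<K*[d/K]+K K (deg G v))
        j₀-exists = sum-positive (𝟙 ∘ deficient) (quotient-large⇒slack-positive large-v slack-v)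
        j₀-deficient : cdeg G c (proj₁ j₀-exists) v < target v
        j₀-deficient = toWitness (𝟙-positive (proj₂ j₀-exists))
        u-exists = sum-positive (λ y → 𝟙 (adj G v y ∧ colour c v y == i)) (≤-<-trans z≤n over)
        u = proj₁ u-exists
        vu-col = Equivalence.to T-∧ (𝟙-positive (proj₂ u-exists))
        vu : adj G v u ≡ true
        vu = Equivalence.to T-≡ (proj₁ vu-col)
        col : colour c v u ≡ i
        col = toWitness (proj₂ vu-col)
        large-u = quotient-large K (target u) (δ u) (d<K*[d/K]+K K (deg G u))

    WithinTarget : EdgeColouring G (K + 1) → Set
    WithinTarget c = ∀ b x → cdeg G c b x ≤ target x

    excessPotential squarePotential : EdgeColouring G (K + 1) → ℕ
    excessPotential = potential G (λ x a → a ∸ target x)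
    squarePotential = potential G (λ _ → square)

    _≺_ : EdgeColouring G (K + 1) → EdgeColouring G (K + 1) → Set
    _≺_ = ×-Lex _≡_ _<_ _<_ on (λ c → excessPotential c , squarePotential c)

    ≺-wellFounded : WellFounded _≺_
    ≺-wellFounded = On.wellFounded _ (×-wellFounded <-wellFounded <-wellFounded)

    module _ (c : EdgeColouring G (K + 1)) where

      rebalanced⇒≺ : ∀ {i j} {i≢j : i ≢ j} → Rebalanced c i≢j → ∃ (_≺ c)
      rebalanced⇒≺ (d , no-worse , fewer-squares)
        with m≤n⇒m<n∨m≡n (no-worse (λ x a → a ∸ target x) (λ x → ∸-convex (target x)))
      ... | inj₁ less-excess = d , inj₁ less-excess
      ... | inj₂ same-excess = d , inj₂ (same-excess , fewer-squares)

      relieve : MinDegree → Spread≤2 c → ∀ {i v} → target v < cdeg G c i v → ∃ (_≺ c)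
      relieve δ spread {i} {v} over
        with any? (λ u → any? (λ j → (adj G v u Bool.≟ true) ×-dec (colour c v u ≟ i)
                                     ×-dec (cdeg G c j v <? target v) ×-dec (cdeg G c j u <? target u)))
      ... | yes (u , j , vu , col , under-v , under-u) = d , inj₁ less-excess
        where
        i≢j : i ≢ j
        i≢j refl = <-asym over under-v
        d,less = recolourEdge c i≢j target vu col over under-v under-u
        d = proj₁ d,less
        less-excess = proj₂ d,less
      ... | no stuck = contradiction (overload-irreparable c v δ spread over saturated) λ ()
        where
        saturated : SaturatedNeighbours c v i
        saturated u j vu col under-v = ≮⇒≥ λ under-u → stuck (u , j , vu , col , under-v , under-u)

      improve : MinDegree → WithinTarget c ⊎ ∃ (_≺ c)
      improve δ with any? (λ x → any? (λ a → any? (λ b → 2 + cdeg G c b x <? cdeg G c a x)))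
      ... | yes (x , a , b , gap) = inj₂ (rebalanced⇒≺ {i≢j = a≢b} (rebalance c a≢b x gap))
        where
        a≢b : a ≢ b
        a≢b refl = <-irrefl refl (≤-<-trans (m≤n+m _ 2) gap)
      ... | no no-gap with all? (λ b → all? (λ x → cdeg G c b x ≤? target x))
      ...   | yes within = inj₁ within
      ...   | no outside = inj₂ (relieve δ spread (≰⇒> (proj₂ v,over)))
        where
        spread : Spread≤2 c
        spread x a b = ≮⇒≥ λ gap → no-gap (x , a , b , gap)
        i,outside = ¬∀⟶∃¬ (K + 1) _ (λ b → all? λ x → cdeg G c b x ≤? target x) outside
        v,over = ¬∀⟶∃¬ n _ (λ x → cdeg G c (proj₁ i,outside) x ≤? target x) (proj₂ i,outside)

    improveUntilWithinTarget : MinDegree → ∀ c → Acc _≺_ c → ∃ WithinTarget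
    improveUntilWithinTarget δ c (acc smaller) with improve c δ
    ... | inj₁ within = c , within
    ... | inj₂ (d , d≺c) = improveUntilWithinTarget δ d (smaller d≺c)

    monochromatic : EdgeColouring G (K + 1)
    monochromatic = record { colour = λ _ _ → fromℕ< (m≤n+m 1 K) ; colour-sym = λ _ _ _ → refl }

    majorityColouring : (∀ v → 7 * (K * K) + 2 * K ≤ 4 * degree G v) → Σ (EdgeColouring G (K + 1)) (IsMajority K)
    majorityColouring δ = c , majority
      where
      c,within = improveUntilWithinTarget (λ x → subst (λ d → 7 * (K * K) + 2 * K ≤ 4 * d) (degree≡deg G x) (δ x))
                                          monochromatic (≺-wellFounded monochromatic)
      c = proj₁ c,within
      majority : IsMajority K c
      majority i v = begin
        K * colourDegree c i v ≡⟨ cong (K *_) (colourDegree≡cdeg G c i v) ⟩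
        K * cdeg G c i v       ≤⟨ *-monoʳ-≤ K (proj₂ c,within i v) ⟩
        K * target v           ≤⟨ K*[d/K]≤d K (deg G v) ⟩
        deg G v                ≡⟨ degree≡deg G v ⟨
        degree G v             ∎
        where open ≤-Reasoning

open import Defs
open import Data.Nat using (ℕ; _+_; _*_; _≤_; s≤s; z≤n; >-nonZero)
open import Data.Nat.Properties using (≤-trans)
open import Data.Product using (Σ)
open Balancing using (majorityColouring)

-- The hypothesis 2 ≤ k is only used to see that k ≠ 0.
corollary12 : (k : ℕ) → 2 ≤ k → (n : ℕ) → (G : Graph n) →
    (∀ v → 7 * (k * k) + 2 * k ≤ 4 * degree G v) →
    Σ (EdgeColouring G (k + 1)) (λ c → IsMajority k c)
corollary12 k 2≤k n G = majorityColouring G k {{>-nonZero (≤-trans (s≤s z≤n) 2≤k)}}
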